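{- Let $(A,B)$ be a conic transition with $r<d$. Then $r'=r$.
   Context: A conic transition is a pair $(A,B)$ of finite abelian $p$-groups, written additively, with: (1) $\mathbb{Z}_p$-linear maps $N:B\to A$ surjective and $\iota:A\to B$ injective with $N(\iota(x))=px$ for $x\in A$; $r=p\text{ -rk}(A)\le r'=p\text{ -rk}(B)$. (2) A finite cyclic $p$-group $\langle\tau\rangle$ acts on $A$ and $B$ (compatibly with $N,\iota$), making $B$ a cyclic $\mathbb{Z}_p[\tau]$-module; $T=\tau-1$. (3) There is a polynomial $\omega(T)$ with coefficients in $\mathbb{Z}/p^M\mathbb{Z}$ ($M$ large, so that $p^M$ kills $B$) with $\omega\equiv T^{d}\pmod p$, $d=\deg\omega\ge1$, $\omega\equiv0\pmod T$, $\omega A=0$, and such that $\iota\circ N$ acts on $B$ as $\nu:=((\omega+1)^p-1)/\omega=\omega^{p-1}+p\,u(\omega)$ with $u$ a unit. (4) $K:=\ker(N:B\to A)=\omega B$, and every $x\in B$ with $\omega x=0$ lies in $\iota(A)$. (5) There is $a\in A$ such that $a, Ta,\dots,T^{r-1}a$ is a minimal system of generators of $A$ over $\mathbb{Z}_p$. Here $p\text{ -rk}(X)=\dim_{\mathbb{F}_p}X/pX$. -}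

module Defs where

open import Level using (Level; _⊔_)
open import Algebra.Bundles using (AbelianGroup)
open import Data.Nat using (ℕ; zero; suc; _≤_; _^_)
open import Data.Nat.Combinatorics using (_C_)
open import Data.Integer using (ℤ; +_; -[1+_]) renaming (_-_ to _-ℤ_)
open import Data.Integer.Divisibility using () renaming (_∣_ to _∣ℤ_)
open import Data.Fin using (Fin; zero; suc; fromℕ; inject₁; toℕ)
open import Data.Vec using (Vec; lookup; toList)
open import Data.List using (List; []; _∷_)
open import Data.Product using (Σ; ∃; _×_; _,_)
open import Function using (_∘_)

-- Basic operations in an abelian group (written multiplicatively in the
-- stdlib record: _∙_, ε, _⁻¹; we use it as an additive group).
module GroupOps {c ℓ} (G : AbelianGroup c ℓ) where
  open AbelianGroup G

  _×ₙ_ : ℕ → Carrier → Carrier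
  zero ×ₙ x = ε
  suc n ×ₙ x = x ∙ (n ×ₙ x)

  _·_ : ℤ → Carrier → Carrier
  (+ n) · x = n ×ₙ x
  -[1+ n ] · x = (suc n ×ₙ x) ⁻¹

  _−_ : Carrier → Carrier → Carrier
  x − y = x ∙ (y ⁻¹)

  ∑ : (k : ℕ) → (Fin k → Carrier) → Carrier
  ∑ zero f = ε
  ∑ (suc k) f = f zero ∙ ∑ k (f ∘ suc)

  iter : ℕ → (Carrier → Carrier) → Carrier → Carrier
  iter zero f x = x
  iter (suc n) f x = f (iter n f x)

  -- polynomial  c₀ + c₁ T + c₂ T² + ...  (coefficient list) applied to x,
  -- for an additive operator T
  polyApp : (Carrier → Carrier) → List ℤ → Carrier → Carrier
  polyApp T [] x = ε
  polyApp T (k ∷ ks) x = (k · x) ∙ polyApp T ks (T x)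

  Top : (Carrier → Carrier) → Carrier → Carrier
  Top τ x = τ x − x

  ωop : (τ : Carrier → Carrier) {d : ℕ} → Vec ℤ (suc d) → Carrier → Carrier
  ωop τ ω = polyApp (Top τ) (toList ω)

  -- ν = ((ω+1)^p − 1)/ω = Σ_{k=1}^{p} (p choose k) ω^{k-1}, applied to x
  νop : (p : ℕ) → (Carrier → Carrier) → Carrier → Carrier
  νop p w x = ∑ p (λ j → (+ (p C suc (toℕ j))) · iter (toℕ j) w x)

  -- group homomorphism property for a map G → H
  -- (for finite abelian p-groups, additive = ℤ_p-linear)

  -- p-rank: dim_{F_p} G/pG = k, witnessed by k elements whose classes form
  -- an F_p-basis of G/pG
  HasPRank : ℕ → ℕ → Set (c ⊔ ℓ)
  HasPRank p k = Σ (Fin k → Carrier) λ x →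
      (∀ y → Σ (Fin k → ℤ) λ n → Σ Carrier λ z →
              y ≈ (∑ k (λ i → n i · x i) ∙ ((+ p) · z)))
    × (∀ (n : Fin k → ℤ) → (Σ Carrier λ z → ∑ k (λ i → n i · x i) ≈ (+ p) · z)
              → ∀ i → (+ p) ∣ℤ n i)

module _ {c₁ ℓ₁ c₂ ℓ₂} (G : AbelianGroup c₁ ℓ₁) (H : AbelianGroup c₂ ℓ₂) where
  private
    module G = AbelianGroup G
    module H = AbelianGroup H

  IsHom : (G.Carrier → H.Carrier) → Set (c₁ ⊔ ℓ₁ ⊔ ℓ₂)
  IsHom f = (∀ {x y} → x G.≈ y → f x H.≈ f y)
          × (∀ x y → f (x G.∙ y) H.≈ (f x H.∙ f y))

record ConicTransition {c₁ ℓ₁ c₂ ℓ₂} (p : ℕ) (A : AbelianGroup c₁ ℓ₁) (B : AbelianGroup c₂ ℓ₂)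
       : Set (c₁ ⊔ ℓ₁ ⊔ c₂ ⊔ ℓ₂) where
  private
    module A = AbelianGroup A
    module B = AbelianGroup B
    module OA = GroupOps A
    module OB = GroupOps B
  field
    -- finite abelian p-groups: finite, and killed by p^M (M large)
    finA : Σ ℕ λ n → Σ (Fin n → A.Carrier) λ f → ∀ x → Σ (Fin n) λ i → f i A.≈ x
    finB : Σ ℕ λ n → Σ (Fin n → B.Carrier) λ f → ∀ x → Σ (Fin n) λ i → f i B.≈ x
    M : ℕ
    killA : ∀ x → (+ (p ^ M)) OA.· x A.≈ A.ε
    killB : ∀ x → (+ (p ^ M)) OB.· x B.≈ B.ε
    N : B.Carrier → A.Carrier
    N-hom : IsHom B A N
    N-surj : ∀ y → Σ B.Carrier λ x → N x A.≈ y
    ι : A.Carrier → B.Carrier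
    ι-hom : IsHom A B ι
    ι-inj : ∀ x y → ι x B.≈ ι y → x A.≈ y
    Nι : ∀ x → N (ι x) A.≈ ((+ p) OA.· x)
    r : ℕ
    r' : ℕ
    r-rank : OA.HasPRank p r
    r'-rank : OB.HasPRank p r'
    r≤r' : r ≤ r'
    -- (2) a cyclic p-group ⟨τ⟩ (of order dividing p^e) acting on A and B
    τA : A.Carrier → A.Carrier
    τA-hom : IsHom A A τA
    τB : B.Carrier → B.Carrier
    τB-hom : IsHom B B τB
    e : ℕ
    τA-order : ∀ x → OA.iter (p ^ e) τA x A.≈ x
    τB-order : ∀ x → OB.iter (p ^ e) τB x B.≈ x
    N-τ : ∀ x → N (τB x) A.≈ τA (N x)
    ι-τ : ∀ x → ι (τA x) B.≈ τB (ι x)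
    B-cyclic : Σ B.Carrier λ b → ∀ x → Σ (List ℤ) λ f → x B.≈ OB.polyApp (OB.Top τB) f b
    -- (3) ω = c₀ + c₁T + … + c_d T^d, coefficients read mod p^M
    d : ℕ
    d≥1 : 1 ≤ d
    ω : Vec ℤ (suc d)
    ω≡Tᵈ-top : (+ p) ∣ℤ (lookup ω (fromℕ d) -ℤ + 1)
    ω≡Tᵈ-low : ∀ (i : Fin d) → (+ p) ∣ℤ lookup ω (inject₁ i)
    ω≡0-modT : (+ (p ^ M)) ∣ℤ lookup ω zero
    ωA≡0 : ∀ x → OA.ωop τA ω x A.≈ A.ε
    ιN≡ν : ∀ x → ι (N x) B.≈ OB.νop p (OB.ωop τB ω) x
    kerN⊆ωB : ∀ x → N x A.≈ A.ε → Σ B.Carrier λ y → x B.≈ OB.ωop τB ω y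
    ωB⊆kerN : ∀ y → N (OB.ωop τB ω y) A.≈ A.ε
    ω-tors⊆ιA : ∀ x → OB.ωop τB ω x B.≈ B.ε → Σ A.Carrier λ y → ι y B.≈ x
    a : A.Carrier
    a-gen : ∀ y → Σ (Fin r → ℤ) λ n →
              y A.≈ OA.∑ r (λ i → n i OA.· OA.iter (toℕ i) (OA.Top τA) a)

{-# OPTIONS --safe #-}

-- Work modulo p.  Since ω ≡ Tᵈ and ν ≡ ω^(p-1) modulo p, while ι ∘ N = ν kills ωB = ker N,
-- the operator T is nilpotent on B/pB.  If b generates B, the r + 1 elements N b, …, Tʳ N b of A,
-- which is generated by r elements, satisfy a relation modulo p with a unit coefficient; lifting
-- it along N puts Σ cⱼ Tʲ b into ker N + pB = ωB + pB ⊆ Tᵈ B + pB.  Because r < d, the lowest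
-- unit term gives c Tˢ b ≡ T (S (Tˢ b)) with S commuting with T, and nilpotency forces
-- Tˢ b ∈ pB for some s ≤ r.  Hence b, T b, …, Tˢ⁻¹ b span B/pB, so r' ≤ s ≤ r.

module Submission where

open import Defs
open import Level using (_⊔_)
open import Algebra.Bundles using (AbelianGroup)
open import Data.Nat as ℕ using (ℕ; zero; suc; _<_; _≤_; s≤s; z≤n; _!)
import Data.Nat.Properties as ℕ
import Data.Nat.Divisibility as ℕ
open import Data.Nat.DivMod using (m/n*n≡m)
open import Data.Nat.Combinatorics using (nCn≡1; k![n∸k]!∣n!; nCk≡n!/k![n-k]!) renaming (_C_ to _choose_)
open import Data.Nat.Coprimality using (Coprime; coprime-Bézout)
open import Data.Nat.GCD using (module Bézout)
open import Data.Nat.Primality using (Prime; euclidsLemma; ¬prime[0]; ¬prime[1]; prime⇒irreducible)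
open import Data.Integer as ℤ using (ℤ; +_; -[1+_]; _⊖_)
import Data.Integer.Properties as ℤ
open import Data.Integer.Divisibility.Signed using (_∣_; divides; _∣?_; ∣ᵤ⇒∣; ∣⇒∣ᵤ; ∣m∣n⇒∣m+n; ∣n⇒∣m*n)
open import Data.Integer.Tactic.RingSolver using (solve-∀)
import Algebra.Properties.CommutativeMonoid.Sum
import Algebra.Properties.Semiring.Sum ℤ.+-*-semiring as ℤSum
open import Data.Fin using (Fin; zero; suc; toℕ; inject₁; fromℕ; punchIn)
open import Data.Fin.Properties using (all?; ¬∀⟶∃¬; toℕ-inject₁; toℕ-fromℕ; toℕ<n)
open import Data.Vec using (Vec; _∷_; []; lookup; toList)
open import Data.Vec.Functional using (insertAt)
open import Data.Vec.Functional.Properties using (insertAt-lookup; insertAt-punchIn)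
open import Data.List using (List; []; _∷_; tabulate; length)
open import Data.List.Properties using (length-tabulate)
open import Data.List.Relation.Unary.Any using (Any; here; there)
open import Data.List.Relation.Unary.Any.Properties using (tabulate⁺)
open import Data.Product using (Σ; _,_; proj₁; proj₂; _×_)
open import Data.Sum using (inj₁; inj₂)
open import Data.Empty using (⊥-elim)
open import Function using (_∘_)
open import Relation.Nullary using (¬_; yes; no)
open import Relation.Binary.PropositionalEquality as ≡ using (_≡_)

module Multiples {c ℓ} (G : AbelianGroup c ℓ) where
  open AbelianGroup G
  open GroupOps G
  open import Algebra.Properties.AbelianGroup G using (ε⁻¹≈ε; ⁻¹-involutive; ⁻¹-∙-comm; xyx⁻¹≈y)
  open import Algebra.Properties.CommutativeSemigroup commutativeSemigroup using (interchange)
  open import Relation.Binary.Reasoning.Setoid setoid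

  ×-congʳ : ∀ n {x y} → x ≈ y → n ×ₙ x ≈ n ×ₙ y
  ×-congʳ zero    x≈y = refl
  ×-congʳ (suc n) x≈y = ∙-cong x≈y (×-congʳ n x≈y)

  ×-homo-+ : ∀ m n x → (m ℕ.+ n) ×ₙ x ≈ m ×ₙ x ∙ n ×ₙ x
  ×-homo-+ zero    n x = sym (identityˡ _)
  ×-homo-+ (suc m) n x = trans (∙-congˡ (×-homo-+ m n x)) (sym (assoc _ _ _))

  ×-distrib-∙ : ∀ n x y → n ×ₙ (x ∙ y) ≈ n ×ₙ x ∙ n ×ₙ y
  ×-distrib-∙ zero    x y = sym (identityˡ _)
  ×-distrib-∙ (suc n) x y = trans (∙-congˡ (×-distrib-∙ n x y)) (interchange _ _ _ _)

  ×-zeroʳ : ∀ n → n ×ₙ ε ≈ ε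
  ×-zeroʳ zero    = refl
  ×-zeroʳ (suc n) = trans (identityˡ _) (×-zeroʳ n)

  ×-homo-⁻¹ : ∀ n x → n ×ₙ (x ⁻¹) ≈ (n ×ₙ x) ⁻¹
  ×-homo-⁻¹ zero    x = sym ε⁻¹≈ε
  ×-homo-⁻¹ (suc n) x = trans (∙-congˡ (×-homo-⁻¹ n x)) (⁻¹-∙-comm _ _)

  ·-congʳ : ∀ m {x y} → x ≈ y → m · x ≈ m · y
  ·-congʳ (+ n)    x≈y = ×-congʳ n x≈y
  ·-congʳ -[1+ n ] x≈y = ⁻¹-cong (×-congʳ (suc n) x≈y)

  ·-identityˡ : ∀ x → (+ 1) · x ≈ x
  ·-identityˡ = identityʳ

  ·-zeroʳ : ∀ m → m · ε ≈ ε
  ·-zeroʳ (+ n)    = ×-zeroʳ n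
  ·-zeroʳ -[1+ n ] = trans (⁻¹-cong (×-zeroʳ (suc n))) ε⁻¹≈ε

  ·-distrib-∙ : ∀ m x y → m · (x ∙ y) ≈ m · x ∙ m · y
  ·-distrib-∙ (+ n)    x y = ×-distrib-∙ n x y
  ·-distrib-∙ -[1+ n ] x y = trans (⁻¹-cong (×-distrib-∙ (suc n) x y)) (sym (⁻¹-∙-comm _ _))

  ·-homo-neg : ∀ m x → (ℤ.- m) · x ≈ (m · x) ⁻¹
  ·-homo-neg (+ zero)  x = sym ε⁻¹≈ε
  ·-homo-neg (+ suc n) x = refl
  ·-homo-neg -[1+ n ]  x = sym (⁻¹-involutive _)

  ·-homo-⊖ : ∀ m n x → (m ⊖ n) · x ≈ m ×ₙ x ∙ (n ×ₙ x) ⁻¹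
  ·-homo-⊖ zero    zero    x = sym (trans (identityˡ _) ε⁻¹≈ε)
  ·-homo-⊖ zero    (suc n) x = sym (identityˡ _)
  ·-homo-⊖ (suc m) zero    x = sym (trans (∙-congˡ ε⁻¹≈ε) (identityʳ _))
  ·-homo-⊖ (suc m) (suc n) x = begin
    (suc m ⊖ suc n) · x                   ≡⟨ ≡.cong (_· x) (ℤ.[1+m]⊖[1+n]≡m⊖n m n) ⟩
    (m ⊖ n) · x                           ≈⟨ ·-homo-⊖ m n x ⟩
    m ×ₙ x ∙ (n ×ₙ x) ⁻¹                  ≈⟨ xyx⁻¹≈y x _ ⟨
    x ∙ (m ×ₙ x ∙ (n ×ₙ x) ⁻¹) ∙ x ⁻¹     ≈⟨ trans (∙-congʳ (sym (assoc _ _ _))) (assoc _ _ _) ⟩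
    (x ∙ m ×ₙ x) ∙ ((n ×ₙ x) ⁻¹ ∙ x ⁻¹)   ≈⟨ ∙-congˡ (trans (comm _ _) (⁻¹-∙-comm _ _)) ⟩
    (x ∙ m ×ₙ x) ∙ (x ∙ n ×ₙ x) ⁻¹        ∎

  ·-homo-+ : ∀ m n x → (m ℤ.+ n) · x ≈ m · x ∙ n · x
  ·-homo-+ (+ m)    (+ n)    x = ×-homo-+ m n x
  ·-homo-+ (+ m)    -[1+ n ] x = ·-homo-⊖ m (suc n) x
  ·-homo-+ -[1+ m ] (+ n)    x = trans (·-homo-⊖ n (suc m) x) (comm _ _)
  ·-homo-+ -[1+ m ] -[1+ n ] x = begin
    (x ∙ (x ∙ (m ℕ.+ n) ×ₙ x)) ⁻¹         ≈⟨ ⁻¹-cong (∙-congˡ (∙-congˡ (×-homo-+ m n x))) ⟩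
    (x ∙ (x ∙ (m ×ₙ x ∙ n ×ₙ x))) ⁻¹      ≈⟨ ⁻¹-cong (∙-congˡ (sym (assoc _ _ _))) ⟩
    (x ∙ ((x ∙ m ×ₙ x) ∙ n ×ₙ x)) ⁻¹      ≈⟨ ⁻¹-cong (∙-congˡ (∙-congʳ (comm _ _))) ⟩
    (x ∙ ((m ×ₙ x ∙ x) ∙ n ×ₙ x)) ⁻¹      ≈⟨ ⁻¹-cong (trans (∙-congˡ (assoc _ _ _)) (sym (assoc _ _ _))) ⟩
    ((x ∙ m ×ₙ x) ∙ (x ∙ n ×ₙ x)) ⁻¹      ≈⟨ ⁻¹-∙-comm _ _ ⟨
    (x ∙ m ×ₙ x) ⁻¹ ∙ (x ∙ n ×ₙ x) ⁻¹     ∎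

  private
    ·-assoc⁺ : ∀ m n x → (+ m ℤ.* n) · x ≈ (+ m) · (n · x)
    ·-assoc⁺ zero    n x = ≡.subst (λ k → k · x ≈ ε) (≡.sym (ℤ.*-zeroˡ n)) refl
    ·-assoc⁺ (suc m) n x = begin
      (+ suc m ℤ.* n) · x         ≡⟨ ≡.cong (_· x) (ℤ.suc-* (+ m) n) ⟩
      (n ℤ.+ + m ℤ.* n) · x       ≈⟨ ·-homo-+ n (+ m ℤ.* n) x ⟩
      n · x ∙ (+ m ℤ.* n) · x     ≈⟨ ∙-congˡ (·-assoc⁺ m n x) ⟩
      n · x ∙ (+ m) · (n · x)     ∎

  ·-assoc : ∀ m n x → (m ℤ.* n) · x ≈ m · (n · x)
  ·-assoc (+ m)    n x = ·-assoc⁺ m n x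
  ·-assoc -[1+ m ] n x = begin
    (-[1+ m ] ℤ.* n) · x          ≡⟨ ≡.cong (_· x) (ℤ.neg-distribˡ-* (+ suc m) n) ⟨
    (ℤ.- (+ suc m ℤ.* n)) · x     ≈⟨ ·-homo-neg (+ suc m ℤ.* n) x ⟩
    ((+ suc m ℤ.* n) · x) ⁻¹      ≈⟨ ⁻¹-cong (·-assoc⁺ (suc m) n x) ⟩
    -[1+ m ] · (n · x)            ∎

  ∑-cong : ∀ k {f g : Fin k → Carrier} → (∀ i → f i ≈ g i) → ∑ k f ≈ ∑ k g
  ∑-cong zero    f≈g = refl
  ∑-cong (suc k) f≈g = ∙-cong (f≈g zero) (∑-cong k (f≈g ∘ suc))

  ∑-zero : ∀ k → ∑ k (λ _ → ε) ≈ ε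
  ∑-zero zero    = refl
  ∑-zero (suc k) = trans (identityˡ _) (∑-zero k)

  ·-distrib-∑ : ∀ m k f → m · ∑ k f ≈ ∑ k (λ i → m · f i)
  ·-distrib-∑ m zero    f = ·-zeroʳ m
  ·-distrib-∑ m (suc k) f = trans (·-distrib-∙ m _ _) (∙-congˡ (·-distrib-∑ m k (f ∘ suc)))

  ∑-·-distribʳ : ∀ k (c : Fin k → ℤ) x → ∑ k (λ i → c i · x) ≈ ℤSum.sum c · x
  ∑-·-distribʳ zero    c x = refl
  ∑-·-distribʳ (suc k) c x = trans (∙-congˡ (∑-·-distribʳ k (c ∘ suc) x)) (sym (·-homo-+ (c zero) _ x))

  private
    module Sum = Algebra.Properties.CommutativeMonoid.Sum commutativeMonoid

    ∑≡sum : ∀ k f → ∑ k f ≡ Sum.sum f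
    ∑≡sum zero    f = ≡.refl
    ∑≡sum (suc k) f = ≡.cong (f zero ∙_) (∑≡sum k (f ∘ suc))

  ∑-comm : ∀ m k (f : Fin m → Fin k → Carrier) → ∑ m (λ j → ∑ k (f j)) ≈ ∑ k (λ i → ∑ m (λ j → f j i))
  ∑-comm m k f = begin
    ∑ m (λ j → ∑ k (f j))                ≡⟨ ≡.trans (∑≡sum m _) (Sum.sum-cong-≗ (λ j → ∑≡sum k (f j))) ⟩
    Sum.sum (λ j → Sum.sum (f j))         ≈⟨ Sum.∑-comm f ⟩
    Sum.sum (λ i → Sum.sum (λ j → f j i)) ≡⟨ ≡.trans (∑≡sum k _) (Sum.sum-cong-≗ (λ i → ∑≡sum m (λ j → f j i))) ⟨
    ∑ k (λ i → ∑ m (λ j → f j i))         ∎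

  ∑-init-last : ∀ k (f : Fin (suc k) → Carrier) → ∑ (suc k) f ≈ ∑ k (f ∘ inject₁) ∙ f (fromℕ k)
  ∑-init-last k f = begin
    ∑ (suc k) f                      ≡⟨ ∑≡sum (suc k) f ⟩
    Sum.sum f                        ≈⟨ Sum.sum-init-last f ⟩
    Sum.sum (f ∘ inject₁) ∙ f (fromℕ k) ≡⟨ ≡.cong (_∙ f (fromℕ k)) (∑≡sum k (f ∘ inject₁)) ⟨
    ∑ k (f ∘ inject₁) ∙ f (fromℕ k)  ∎

module CongruenceModP {c ℓ} (G : AbelianGroup c ℓ) (p : ℕ) where
  open AbelianGroup G
  open GroupOps G
  open Multiples G
  open import Algebra.Properties.CommutativeSemigroup commutativeSemigroup using (interchange)

  -- Congruence modulo pG: we compute in G/pG without forming the quotient.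
  infix 4 _∼_
  _∼_ : Carrier → Carrier → Set (c ⊔ ℓ)
  x ∼ y = Σ Carrier λ z → x ≈ y ∙ p ×ₙ z

  ≈⇒∼ : ∀ {x y} → x ≈ y → x ∼ y
  ≈⇒∼ {x} {y} x≈y = ε , trans x≈y (sym (trans (∙-congˡ (×-zeroʳ p)) (identityʳ y)))

  ∼-refl : ∀ {x} → x ∼ x
  ∼-refl = ≈⇒∼ refl

  ∼-sym : ∀ {x y} → x ∼ y → y ∼ x
  ∼-sym {x} {y} (z , x≈y+pz) = z ⁻¹ , (begin
    y                                ≈⟨ identityʳ y ⟨
    y ∙ ε                            ≈⟨ ∙-congˡ (inverseʳ (p ×ₙ z)) ⟨
    y ∙ (p ×ₙ z ∙ (p ×ₙ z) ⁻¹)       ≈⟨ assoc _ _ _ ⟨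
    (y ∙ p ×ₙ z) ∙ (p ×ₙ z) ⁻¹       ≈⟨ ∙-cong x≈y+pz (×-homo-⁻¹ p z) ⟨
    x ∙ p ×ₙ (z ⁻¹)                  ∎)
    where open import Relation.Binary.Reasoning.Setoid setoid

  ∼-trans : ∀ {x y w} → x ∼ y → y ∼ w → x ∼ w
  ∼-trans {x} {y} {w} (z , x≈y+pz) (z′ , y≈w+pz′) = z′ ∙ z , (begin
    x                                ≈⟨ x≈y+pz ⟩
    y ∙ p ×ₙ z                       ≈⟨ ∙-congʳ y≈w+pz′ ⟩
    (w ∙ p ×ₙ z′) ∙ p ×ₙ z           ≈⟨ assoc _ _ _ ⟩
    w ∙ (p ×ₙ z′ ∙ p ×ₙ z)           ≈⟨ ∙-congˡ (×-distrib-∙ p z′ z) ⟨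
    w ∙ p ×ₙ (z′ ∙ z)                ∎)
    where open import Relation.Binary.Reasoning.Setoid setoid

  module ∼-Reasoning where
    open import Relation.Binary.Reasoning.Base.Single _∼_ ∼-refl ∼-trans public
    open import Relation.Binary.Reasoning.Syntax using (module ≈-syntax)
    open ≈-syntax _IsRelatedTo_ _IsRelatedTo_ (λ x≈y → ∼-go (≈⇒∼ x≈y)) sym public

  ∙-cong-∼ : ∀ {x x′ y y′} → x ∼ x′ → y ∼ y′ → x ∙ y ∼ x′ ∙ y′
  ∙-cong-∼ {x} {x′} {y} {y′} (z , x≈x′+pz) (z′ , y≈y′+pz′) = z ∙ z′ , (begin
    x ∙ y                            ≈⟨ ∙-cong x≈x′+pz y≈y′+pz′ ⟩
    (x′ ∙ p ×ₙ z) ∙ (y′ ∙ p ×ₙ z′)   ≈⟨ interchange _ _ _ _ ⟩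
    (x′ ∙ y′) ∙ (p ×ₙ z ∙ p ×ₙ z′)   ≈⟨ ∙-congˡ (×-distrib-∙ p z z′) ⟨
    (x′ ∙ y′) ∙ p ×ₙ (z ∙ z′)        ∎)
    where open import Relation.Binary.Reasoning.Setoid setoid

  ·-cong-∼ : ∀ m {x y} → x ∼ y → m · x ∼ m · y
  ·-cong-∼ m {x} {y} (z , x≈y+pz) = m · z , (begin
    m · x                            ≈⟨ ·-congʳ m x≈y+pz ⟩
    m · (y ∙ p ×ₙ z)                 ≈⟨ ·-distrib-∙ m y _ ⟩
    m · y ∙ m · ((+ p) · z)          ≈⟨ ∙-congˡ (·-assoc m (+ p) z) ⟨
    m · y ∙ (m ℤ.* + p) · z          ≡⟨ ≡.cong (λ k → m · y ∙ k · z) (ℤ.*-comm m (+ p)) ⟩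
    m · y ∙ (+ p ℤ.* m) · z          ≈⟨ ∙-congˡ (·-assoc (+ p) m z) ⟩
    m · y ∙ p ×ₙ (m · z)             ∎)
    where open import Relation.Binary.Reasoning.Setoid setoid

  ∑-cong-∼ : ∀ k {f g : Fin k → Carrier} → (∀ i → f i ∼ g i) → ∑ k f ∼ ∑ k g
  ∑-cong-∼ zero    f∼g = ∼-refl
  ∑-cong-∼ (suc k) f∼g = ∙-cong-∼ (f∼g zero) (∑-cong-∼ k (f∼g ∘ suc))

  p∣⇒·∼ε : ∀ m x → + p ∣ m → m · x ∼ ε
  p∣⇒·∼ε m x (divides q m≡q*p) = q · x , (begin
    m · x                  ≡⟨ ≡.cong (_· x) (≡.trans m≡q*p (ℤ.*-comm q (+ p))) ⟩
    (+ p ℤ.* q) · x        ≈⟨ ·-assoc (+ p) q x ⟩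
    p ×ₙ (q · x)           ≈⟨ identityˡ _ ⟨
    ε ∙ p ×ₙ (q · x)       ∎)
    where open import Relation.Binary.Reasoning.Setoid setoid

  p∣m-1⇒·∼ : ∀ m x → + p ∣ m ℤ.- + 1 → m · x ∼ x
  p∣m-1⇒·∼ m x p∣m-1 = let open ∼-Reasoning in begin
    m · x                          ≡⟨ ≡.cong (_· x) (split m) ⟩
    (m ℤ.- + 1 ℤ.+ + 1) · x        ≈⟨ ·-homo-+ (m ℤ.- + 1) (+ 1) x ⟩
    (m ℤ.- + 1) · x ∙ (+ 1) · x    ∼⟨ ∙-cong-∼ (p∣⇒·∼ε (m ℤ.- + 1) x p∣m-1) ∼-refl ⟩
    ε ∙ (+ 1) · x                  ≈⟨ trans (identityˡ _) (·-identityˡ x) ⟩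
    x                              ∎
    where
    split : ∀ m → m ≡ m ℤ.- + 1 ℤ.+ + 1
    split = solve-∀

module Homomorphism {c₁ ℓ₁ c₂ ℓ₂} (G : AbelianGroup c₁ ℓ₁) (H : AbelianGroup c₂ ℓ₂)
                    {f : AbelianGroup.Carrier G → AbelianGroup.Carrier H} (f-hom : IsHom G H f) where
  private
    module G = AbelianGroup G
    module H = AbelianGroup H
    module OG = GroupOps G
    module OH = GroupOps H
  open import Algebra.Properties.AbelianGroup H using (inverseʳ-unique)
  open import Relation.Binary.Reasoning.Setoid H.setoid

  f-cong : ∀ {x y} → x G.≈ y → f x H.≈ f y
  f-cong = proj₁ f-hom

  f-∙ : ∀ x y → f (x G.∙ y) H.≈ f x H.∙ f y
  f-∙ = proj₂ f-hom

  f-ε : f G.ε H.≈ H.ε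
  f-ε = begin
    f G.ε                              ≈⟨ H.identityʳ _ ⟨
    f G.ε H.∙ H.ε                      ≈⟨ H.∙-congˡ (H.inverseʳ (f G.ε)) ⟨
    f G.ε H.∙ (f G.ε H.∙ f G.ε H.⁻¹)   ≈⟨ H.assoc _ _ _ ⟨
    (f G.ε H.∙ f G.ε) H.∙ f G.ε H.⁻¹   ≈⟨ H.∙-congʳ (f-∙ G.ε G.ε) ⟨
    f (G.ε G.∙ G.ε) H.∙ f G.ε H.⁻¹     ≈⟨ H.∙-congʳ (f-cong (G.identityˡ G.ε)) ⟩
    f G.ε H.∙ f G.ε H.⁻¹               ≈⟨ H.inverseʳ _ ⟩
    H.ε                                ∎

  f-⁻¹ : ∀ x → f (x G.⁻¹) H.≈ f x H.⁻¹
  f-⁻¹ x = inverseʳ-unique (f x) (f (x G.⁻¹))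
    (H.trans (H.sym (f-∙ x (x G.⁻¹))) (H.trans (f-cong (G.inverseʳ x)) f-ε))

  f-× : ∀ n x → f (n OG.×ₙ x) H.≈ n OH.×ₙ f x
  f-× zero    x = f-ε
  f-× (suc n) x = H.trans (f-∙ _ _) (H.∙-congˡ (f-× n x))

  f-· : ∀ m x → f (m OG.· x) H.≈ m OH.· f x
  f-· (+ n)      x = f-× n x
  f-· ℤ.-[1+ n ] x = H.trans (f-⁻¹ _) (H.⁻¹-cong (f-× (suc n) x))

  f-∑ : ∀ k g → f (OG.∑ k g) H.≈ OH.∑ k (f ∘ g)
  f-∑ zero    g = f-ε
  f-∑ (suc k) g = H.trans (f-∙ _ _) (H.∙-congˡ (f-∑ k (g ∘ suc)))

  f-∼ : ∀ p {x y} → CongruenceModP._∼_ G p x y → CongruenceModP._∼_ H p (f x) (f y)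
  f-∼ p (z , x≈y+pz) = f z , H.trans (f-cong x≈y+pz) (H.trans (f-∙ _ _) (H.∙-congˡ (f-× p z)))

  f-∼ε : ∀ p {x} → CongruenceModP._∼_ G p x G.ε → CongruenceModP._∼_ H p (f x) H.ε
  f-∼ε p x∼ε = let z , fx≈fε+pz = f-∼ p x∼ε in z , H.trans fx≈fε+pz (H.∙-congʳ f-ε)

module Endomorphisms {c ℓ} (G : AbelianGroup c ℓ) where
  open AbelianGroup G
  open GroupOps G
  open Multiples G
  open import Algebra.Properties.AbelianGroup G using (⁻¹-∙-comm)
  open import Algebra.Properties.CommutativeSemigroup commutativeSemigroup using (interchange)
  open import Relation.Binary.Reasoning.Setoid setoid

  IsEndo : (Carrier → Carrier) → Set (c ⊔ ℓ)
  IsEndo = IsHom G G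

  Commute : (Carrier → Carrier) → (Carrier → Carrier) → Set (c ⊔ ℓ)
  Commute S T = ∀ x → S (T x) ≈ T (S x)

  iter-suc : ∀ n (g : Carrier → Carrier) x → iter n g (g x) ≡ iter (suc n) g x
  iter-suc zero    g x = ≡.refl
  iter-suc (suc n) g x = ≡.cong g (iter-suc n g x)

  iter-+ : ∀ m n (g : Carrier → Carrier) x → iter (m ℕ.+ n) g x ≡ iter m g (iter n g x)
  iter-+ zero    n g x = ≡.refl
  iter-+ (suc m) n g x = ≡.cong g (iter-+ m n g x)

  iter-* : ∀ m n (g : Carrier → Carrier) x → iter (m ℕ.* n) g x ≡ iter m (iter n g) x
  iter-* zero    n g x = ≡.refl
  iter-* (suc m) n g x = ≡.trans (iter-+ n (m ℕ.* n) g x) (≡.cong (iter n g) (iter-* m n g x))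

  id-endo : IsEndo (λ x → x)
  id-endo = (λ x≈y → x≈y) , (λ x y → refl)

  ∘-endo : ∀ {S U} → IsEndo S → IsEndo U → IsEndo (S ∘ U)
  ∘-endo (S-cong , S-∙) (U-cong , U-∙) = S-cong ∘ U-cong , λ x y → trans (S-cong (U-∙ x y)) (S-∙ _ _)

  iter-endo : ∀ n {T} → IsEndo T → IsEndo (iter n T)
  iter-endo zero    T-endo = id-endo
  iter-endo (suc n) T-endo = ∘-endo T-endo (iter-endo n T-endo)

  ∙-endo : ∀ {S U} → IsEndo S → IsEndo U → IsEndo (λ x → S x ∙ U x)
  ∙-endo (S-cong , S-∙) (U-cong , U-∙) =
    (λ x≈y → ∙-cong (S-cong x≈y) (U-cong x≈y)) ,
    (λ x y → trans (∙-cong (S-∙ x y) (U-∙ x y)) (interchange _ _ _ _))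

  ⁻¹-endo : ∀ {S} → IsEndo S → IsEndo (λ x → S x ⁻¹)
  ⁻¹-endo (S-cong , S-∙) =
    ⁻¹-cong ∘ S-cong , (λ x y → trans (⁻¹-cong (S-∙ x y)) (sym (⁻¹-∙-comm _ _)))

  ·-endo : ∀ m {S} → IsEndo S → IsEndo (λ x → m · S x)
  ·-endo m (S-cong , S-∙) = ·-congʳ m ∘ S-cong , (λ x y → trans (·-congʳ m (S-∙ x y)) (·-distrib-∙ m _ _))

  Top-endo : ∀ {τ} → IsEndo τ → IsEndo (Top τ)
  Top-endo τ-endo = ∙-endo τ-endo (⁻¹-endo id-endo)

  polyApp-endo : ∀ {T} → IsEndo T → ∀ cs → IsEndo (polyApp T cs)
  polyApp-endo T-endo []       = (λ _ → refl) , (λ x y → sym (identityˡ ε))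
  polyApp-endo T-endo (k ∷ cs) = ∙-endo (·-endo k id-endo)
                                        (∘-endo (polyApp-endo T-endo cs) T-endo)

  commute-sym : ∀ {S T} → Commute S T → Commute T S
  commute-sym S∘T≈T∘S x = sym (S∘T≈T∘S x)

  iter-commute : ∀ n T → Commute (iter n T) T
  iter-commute n T x = reflexive (iter-suc n T x)

  commute-iter : ∀ {S T} → IsEndo T → Commute S T → ∀ n → Commute S (iter n T)
  commute-iter T-endo S∘T≈T∘S zero    x = refl
  commute-iter T-endo S∘T≈T∘S (suc n) x =
    trans (S∘T≈T∘S _) (proj₁ T-endo (commute-iter T-endo S∘T≈T∘S n x))

  commute-polyApp : ∀ {S T} → IsEndo S → IsEndo T → Commute S T → ∀ cs → Commute S (polyApp T cs)
  commute-polyApp S-endo T-endo S∘T≈T∘S []       x = f-ε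
    where open Homomorphism G G S-endo
  commute-polyApp {S} {T} S-endo T-endo S∘T≈T∘S (k ∷ cs) x = begin
    S (k · x ∙ polyApp T cs (T x))            ≈⟨ f-∙ _ _ ⟩
    S (k · x) ∙ S (polyApp T cs (T x))        ≈⟨ ∙-cong (f-· k x) (commute-polyApp S-endo T-endo S∘T≈T∘S cs (T x)) ⟩
    k · S x ∙ polyApp T cs (S (T x))          ≈⟨ ∙-congˡ (proj₁ (polyApp-endo T-endo cs) (S∘T≈T∘S x)) ⟩
    k · S x ∙ polyApp T cs (T (S x))          ∎
    where open Homomorphism G G S-endo

  polyApp-commute : ∀ {T} → IsEndo T → ∀ cs → Commute (polyApp T cs) T
  polyApp-commute {T} T-endo cs = commute-sym {T} (commute-polyApp T-endo T-endo (λ _ → refl) cs)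

  commute-∘ : ∀ {S U T} → IsEndo S → Commute S T → Commute U T → Commute (S ∘ U) T
  commute-∘ S-endo S∘T≈T∘S U∘T≈T∘U x = trans (proj₁ S-endo (U∘T≈T∘U x)) (S∘T≈T∘S _)

  commute-∙ : ∀ {S U T} → IsEndo T → Commute S T → Commute U T → Commute (λ x → S x ∙ U x) T
  commute-∙ T-endo S∘T≈T∘S U∘T≈T∘U x = trans (∙-cong (S∘T≈T∘S x) (U∘T≈T∘U x)) (sym (proj₂ T-endo _ _))

  commute-⁻¹ : ∀ {S T} → IsEndo T → Commute S T → Commute (λ x → S x ⁻¹) T
  commute-⁻¹ T-endo S∘T≈T∘S x = trans (⁻¹-cong (S∘T≈T∘S x)) (sym (f-⁻¹ _))
    where open Homomorphism G G T-endo

  commute-· : ∀ m {S T} → IsEndo T → Commute S T → Commute (λ x → m · S x) T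
  commute-· m T-endo S∘T≈T∘S x = trans (·-congʳ m (S∘T≈T∘S x)) (sym (f-· m _))
    where open Homomorphism G G T-endo

module ModPrime {p : ℕ} (p-prime : Prime p) where
  open import Data.Integer.Base using (_*_; _+_; _-_; -_; ∣_∣)
  open ℤSum using (sum; sum-remove; sum-cong-≗; ∑-distrib-+; *-distribˡ-sum)

  private
    ¬∣-of-< : ∀ {m} → 0 < m → m < p → ¬ p ℕ.∣ m
    ¬∣-of-< 0<m m<p p∣m = ℕ.<⇒≱ m<p (ℕ.∣⇒≤ ⦃ ℕ.>-nonZero 0<m ⦄ p∣m)

  prime∤! : ∀ {m} → m < p → ¬ p ℕ.∣ m !
  prime∤! {zero}  _   p∣1 = ¬prime[1] (≡.subst Prime (ℕ.∣1⇒≡1 p∣1) p-prime)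
  prime∤! {suc m} m<p p∣m! with euclidsLemma (suc m) (m !) p-prime p∣m!
  ... | inj₁ p∣1+m = ¬∣-of-< (s≤s z≤n) m<p p∣1+m
  ... | inj₂ p∣m!  = prime∤! (ℕ.<-trans (ℕ.n<1+n m) m<p) p∣m!

  private
    n∣n! : ∀ {n} → 0 < n → n ℕ.∣ n !
    n∣n! {suc n} _ = ℕ.m∣m*n (n !)

    C*k![n∸k]!≡n! : ∀ {n k} → k ≤ n → (n choose k) ℕ.* (k ! ℕ.* (n ℕ.∸ k) !) ≡ n !
    C*k![n∸k]!≡n! {n} {k} k≤n = ≡.trans
      (≡.cong (ℕ._* (k ! ℕ.* (n ℕ.∸ k) !)) (nCk≡n!/k![n-k]! k≤n))
      (m/n*n≡m ⦃ k ℕ.!* (n ℕ.∸ k) !≢0 ⦄ (k![n∸k]!∣n! k≤n))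

  p∣pCk : ∀ {k} → 0 < k → k < p → p ℕ.∣ p choose k
  p∣pCk {k} 0<k k<p
    with euclidsLemma (p choose k) _ p-prime
           (≡.subst (p ℕ.∣_) (≡.sym (C*k![n∸k]!≡n! (ℕ.<⇒≤ k<p))) (n∣n! (ℕ.<-trans 0<k k<p)))
  ... | inj₁ p∣C = p∣C
  ... | inj₂ p∣k![p∸k]! with euclidsLemma (k !) ((p ℕ.∸ k) !) p-prime p∣k![p∸k]!
  ...   | inj₁ p∣k!     = ⊥-elim (prime∤! k<p p∣k!)
  ...   | inj₂ p∣[p∸k]! = ⊥-elim (prime∤! (ℕ.∸-monoʳ-< 0<k (ℕ.<⇒≤ k<p)) p∣[p∸k]!)

  Unit : ℤ → Set
  Unit c = ¬ (+ p ∣ c)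

  unit-1 : Unit (+ 1)
  unit-1 p∣1 = ¬prime[1] (≡.subst Prime (ℕ.∣1⇒≡1 (∣⇒∣ᵤ p∣1)) p-prime)

  unit-* : ∀ {a b} → Unit a → Unit b → Unit (a * b)
  unit-* {a} {b} ua ub p∣ab
    with euclidsLemma ∣ a ∣ ∣ b ∣ p-prime (≡.subst (p ℕ.∣_) (ℤ.abs-* a b) (∣⇒∣ᵤ p∣ab))
  ... | inj₁ p∣a = ua (∣ᵤ⇒∣ p∣a)
  ... | inj₂ p∣b = ub (∣ᵤ⇒∣ p∣b)

  private
    coprime : ∀ {n} → ¬ p ℕ.∣ n → Coprime p n
    coprime p∤n (d∣p , d∣n) with prime⇒irreducible p-prime d∣p
    ... | inj₁ d≡1 = d≡1
    ... | inj₂ ≡.refl = ⊥-elim (p∤n d∣n)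

    lift-1+ab≡cd : ∀ a b c d → 1 ℕ.+ a ℕ.* b ≡ c ℕ.* d → + 1 + + a * + b ≡ + c * + d
    lift-1+ab≡cd a b c d eq = ≡.trans (≡.cong (λ t → + 1 + t) (≡.sym (ℤ.pos-* a b)))
      (≡.trans (≡.sym (ℤ.pos-+ 1 (a ℕ.* b))) (≡.trans (≡.cong +_ eq) (ℤ.pos-* c d)))

    bézout-inverse : ∀ {n} → Bézout.Identity 1 p n → Σ ℤ λ u → + p ∣ u * + n - + 1
    bézout-inverse {n} (Bézout.+- x y eq) = - + y , divides (- + x) (begin
      - + y * + n - + 1     ≡⟨ rearrange (+ y) (+ n) ⟩
      - (+ 1 + + y * + n)   ≡⟨ ≡.cong -_ (lift-1+ab≡cd y n x p eq) ⟩
      - (+ x * + p)         ≡⟨ ℤ.neg-distribˡ-* (+ x) (+ p) ⟩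
      - + x * + p           ∎)
      where
      open ≡.≡-Reasoning
      rearrange : ∀ y n → - y * n - + 1 ≡ - (+ 1 + y * n)
      rearrange = solve-∀
    bézout-inverse {n} (Bézout.-+ x y eq) = + y , divides (+ x) (begin
      + y * + n - + 1             ≡⟨ ≡.cong (_- + 1) (lift-1+ab≡cd x p y n eq) ⟨
      (+ 1 + + x * + p) - + 1     ≡⟨ cancel (+ x * + p) ⟩
      + x * + p                   ∎)
      where
      open ≡.≡-Reasoning
      cancel : ∀ t → (+ 1 + t) - + 1 ≡ t
      cancel = solve-∀

  unit-inverse : ∀ {c} → Unit c → Σ ℤ λ c′ → + p ∣ c′ * c - + 1
  unit-inverse {+ n} p∤c = bézout-inverse (coprime-Bézout (coprime (p∤c ∘ ∣ᵤ⇒∣)))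
  unit-inverse { -[1+ n ]} p∤c with bézout-inverse (coprime-Bézout (coprime (p∤c ∘ ∣ᵤ⇒∣)))
  ... | u , p∣un-1 = - u , ≡.subst (λ t → + p ∣ t - + 1) (negate-both u (+ suc n)) p∣un-1
    where
    negate-both : ∀ u n → u * n ≡ - u * - n
    negate-both = solve-∀

  NontrivialRelation : ∀ {m k} → (Fin m → Fin k → ℤ) → Set
  NontrivialRelation {m} a =
    Σ (Fin m → ℤ) λ c → (Σ (Fin m) λ j → Unit (c j)) × (∀ i → + p ∣ sum (λ j → c j * a j i))

  private
    ∣-sum : ∀ {m} (f : Fin m → ℤ) → (∀ j → + p ∣ f j) → + p ∣ sum f
    ∣-sum {zero}  f p∣f = divides (+ 0) ≡.refl
    ∣-sum {suc m} f p∣f = ∣m∣n⇒∣m+n (p∣f zero) (∣-sum (f ∘ suc) (p∣f ∘ suc))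

    relation-from-tail-columns : ∀ {m k} (a : Fin m → Fin (suc k) → ℤ) → (∀ j → + p ∣ a j zero) →
      NontrivialRelation (λ j i → a j (suc i)) → NontrivialRelation a
    relation-from-tail-columns a p∣col₀ (c , unit , rel) = c , unit , λ where
      zero    → ∣-sum _ (λ j → ∣n⇒∣m*n (c j) (p∣col₀ j))
      (suc i) → rel i

    sum-linear : ∀ {m} (c x y : Fin m → ℤ) α β →
      sum (λ j → c j * (α * x j - y j * β)) ≡ - sum (λ j → c j * y j) * β + α * sum (λ j → c j * x j)
    sum-linear {m} c x y α β = begin
      sum (λ j → c j * (α * x j - y j * β))
        ≡⟨ sum-cong-≗ (λ j → expand (c j) α (x j) (y j) β) ⟩
      sum (λ j → α * (c j * x j) + - β * (c j * y j))
        ≡⟨ ∑-distrib-+ {m} _ _ ⟩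
      sum (λ j → α * (c j * x j)) + sum (λ j → - β * (c j * y j))
        ≡⟨ ≡.cong₂ _+_ (*-distribˡ-sum {m} α _) (*-distribˡ-sum {m} (- β) _) ⟨
      α * sum (λ j → c j * x j) + - β * sum (λ j → c j * y j)
        ≡⟨ reorder α _ β _ ⟩
      - sum (λ j → c j * y j) * β + α * sum (λ j → c j * x j)
        ∎
      where
      open ≡.≡-Reasoning
      expand : ∀ c α x y β → c * (α * x - y * β) ≡ α * (c * x) + - β * (c * y)
      expand = solve-∀
      reorder : ∀ α s β t → α * s + - β * t ≡ - t * β + α * s
      reorder = solve-∀

    -- Clear the first column using the pivot row j₀, scaling by the pivot instead of dividing.
    eliminate : ∀ {m k} → (Fin (suc m) → Fin (suc k) → ℤ) → Fin (suc m) → Fin m → Fin k → ℤ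
    eliminate a j₀ j i = a j₀ zero * a (punchIn j₀ j) (suc i) - a (punchIn j₀ j) zero * a j₀ (suc i)

    relation-from-pivot : ∀ {m k} (a : Fin (suc m) → Fin (suc k) → ℤ) (j₀ : Fin (suc m)) →
      Unit (a j₀ zero) → NontrivialRelation (eliminate a j₀) → NontrivialRelation a
    relation-from-pivot {m} a j₀ unit-α (c′ , (j , unit-c′j) , rel′) =
      c , (punchIn j₀ j , unit-cj) , rel
      where
      open ≡.≡-Reasoning
      α = a j₀ zero
      S : ∀ i → ℤ
      S i = sum (λ j → c′ j * a (punchIn j₀ j) i)
      c = insertAt (λ j → α * c′ j) j₀ (- S zero)

      unit-cj : Unit (c (punchIn j₀ j))
      unit-cj = ≡.subst Unit (≡.sym (insertAt-punchIn _ j₀ _ j)) (unit-* unit-α unit-c′j)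

      split : ∀ i → sum (λ j → c j * a j i) ≡ - S zero * a j₀ i + α * S i
      split i = begin
        sum (λ j → c j * a j i)
          ≡⟨ sum-remove {i = j₀} (λ j → c j * a j i) ⟩
        c j₀ * a j₀ i + sum (λ j → c (punchIn j₀ j) * a (punchIn j₀ j) i)
          ≡⟨ ≡.cong₂ (λ s t → s * a j₀ i + t) (insertAt-lookup _ j₀ _)
               (sum-cong-≗ (λ j → ≡.trans (≡.cong (_* a (punchIn j₀ j) i) (insertAt-punchIn _ j₀ _ j))
                                           (ℤ.*-assoc α (c′ j) _))) ⟩
        - S zero * a j₀ i + sum (λ j → α * (c′ j * a (punchIn j₀ j) i))
          ≡⟨ ≡.cong (λ t → - S zero * a j₀ i + t) (*-distribˡ-sum {m} α _) ⟨
        - S zero * a j₀ i + α * S i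
          ∎

      rel : ∀ i → + p ∣ sum (λ j → c j * a j i)
      rel zero    = ≡.subst (+ p ∣_) (≡.sym (≡.trans (split zero) (cancel (S zero) α))) (divides (+ 0) ≡.refl)
        where
        cancel : ∀ s α → - s * α + α * s ≡ + 0
        cancel = solve-∀
      rel (suc i) = ≡.subst (+ p ∣_)
        (≡.trans (sum-linear c′ (λ j → a (punchIn j₀ j) (suc i)) (λ j → a (punchIn j₀ j) zero) α (a j₀ (suc i)))
                 (≡.sym (split (suc i))))
        (rel′ i)

  k<m⇒nontrivialRelation : ∀ {k m} → k < m → (a : Fin m → Fin k → ℤ) → NontrivialRelation a
  k<m⇒nontrivialRelation {zero}  {suc m} _ a = (λ _ → + 1) , (zero , unit-1) , λ ()
  k<m⇒nontrivialRelation {suc k} {suc m} (s≤s k<m) a with all? (λ j → + p ∣? a j zero)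
  ... | yes p∣col₀ = relation-from-tail-columns a p∣col₀
      (k<m⇒nontrivialRelation (ℕ.m<n⇒m<1+n k<m) (λ j i → a j (suc i)))
  ... | no ¬p∣col₀ with ¬∀⟶∃¬ _ _ (λ j → + p ∣? a j zero) ¬p∣col₀
  ...   | j₀ , unit-α = relation-from-pivot a j₀ unit-α (k<m⇒nontrivialRelation k<m _)

module LinearAlgebraModP {c ℓ} (G : AbelianGroup c ℓ) {p : ℕ} (p-prime : Prime p) where
  open AbelianGroup G
  open GroupOps G
  open Multiples G
  open CongruenceModP G p
  open ModPrime p-prime
  open Endomorphisms G
  open import Algebra.Properties.AbelianGroup G using (//-rightDividesʳ)

  Spans : (k : ℕ) → (Fin k → Carrier) → Set (c ⊔ ℓ)
  Spans k w = ∀ x → Σ (Fin k → ℤ) λ n → x ∼ ∑ k (λ i → n i · w i)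

  spans⇒relation : ∀ {k m w} → Spans k w → k < m → (u : Fin m → Carrier) →
    Σ (Fin m → ℤ) λ c → (Σ (Fin m) λ j → Unit (c j)) × ∑ m (λ j → c j · u j) ∼ ε
  spans⇒relation {k} {m} {w} span k<m u with k<m⇒nontrivialRelation k<m (λ j → proj₁ (span (u j)))
  ... | c , unit , p∣column = c , unit , (begin
    ∑ m (λ j → c j · u j)                              ∼⟨ ∑-cong-∼ m (λ j → ·-cong-∼ (c j) (proj₂ (span (u j)))) ⟩
    ∑ m (λ j → c j · ∑ k (λ i → a j i · w i))          ≈⟨ ∑-cong m (λ j → ·-distrib-∑ (c j) k _) ⟩
    ∑ m (λ j → ∑ k (λ i → c j · (a j i · w i)))        ≈⟨ ∑-cong m (λ j → ∑-cong k (λ i → ·-assoc (c j) (a j i) (w i))) ⟨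
    ∑ m (λ j → ∑ k (λ i → (c j ℤ.* a j i) · w i))      ≈⟨ ∑-comm m k _ ⟩
    ∑ k (λ i → ∑ m (λ j → (c j ℤ.* a j i) · w i))      ≈⟨ ∑-cong k (λ i → ∑-·-distribʳ m _ (w i)) ⟩
    ∑ k (λ i → ℤSum.sum (λ j → c j ℤ.* a j i) · w i)    ∼⟨ ∑-cong-∼ k (λ i → p∣⇒·∼ε _ (w i) (p∣column i)) ⟩
    ∑ k (λ _ → ε)                                      ≈⟨ ∑-zero k ⟩
    ε                                                  ∎)
    where
    open ∼-Reasoning
    a : Fin m → Fin k → ℤ
    a j = proj₁ (span (u j))

  prank≤spans : ∀ {k′ k w} → HasPRank p k′ → Spans k w → k′ ≤ k
  prank≤spans (xs , _ , independent) span = ℕ.≮⇒≥ λ k<k′ →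
    let c , (j , unit-cj) , (z , relation) = spans⇒relation span k<k′ xs
    in unit-cj (∣ᵤ⇒∣ (independent c (z , trans relation (identityˡ _)) j))

  polyApp-∼-iter : ∀ (T : Carrier → Carrier) d (ω : Vec ℤ (suc d)) →
    + p ∣ lookup ω (fromℕ d) ℤ.- + 1 → (∀ i → + p ∣ lookup ω (inject₁ i)) →
    ∀ x → polyApp T (toList ω) x ∼ iter d T x
  polyApp-∼-iter T zero    (c ∷ []) p∣c-1 _ x = let open ∼-Reasoning in begin
    c · x ∙ ε     ≈⟨ identityʳ _ ⟩
    c · x         ∼⟨ p∣m-1⇒·∼ c x p∣c-1 ⟩
    x             ∎
  polyApp-∼-iter T (suc d) (c ∷ ω) p∣top p∣low x = let open ∼-Reasoning in begin
    c · x ∙ polyApp T (toList ω) (T x)   ∼⟨ ∙-cong-∼ (p∣⇒·∼ε c x (p∣low zero)) (polyApp-∼-iter T d ω p∣top (p∣low ∘ suc) (T x)) ⟩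
    ε ∙ iter d T (T x)                   ≈⟨ identityˡ _ ⟩
    iter d T (T x)                       ≡⟨ iter-suc d T x ⟩
    iter (suc d) T x                     ∎

  private
    binomial-sum-∼ : ∀ q w y → (∀ {k} → 0 < k → k < suc q → p ℕ.∣ suc q choose k) →
      νop (suc q) w y ∼ iter q w y
    binomial-sum-∼ q w y p∣C = begin
      ∑ (suc q) f                     ≈⟨ ∑-init-last q f ⟩
      ∑ q (f ∘ inject₁) ∙ f (fromℕ q) ∼⟨ ∙-cong-∼ (∑-cong-∼ q inner-term∼ε) ∼-refl ⟩
      ∑ q (λ _ → ε) ∙ f (fromℕ q)     ≈⟨ trans (∙-congʳ (∑-zero q)) (identityˡ _) ⟩
      f (fromℕ q)                     ≡⟨ ≡.cong (λ j → (+ (suc q choose suc j)) · iter j w y) (toℕ-fromℕ q) ⟩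
      (+ (suc q choose suc q)) · iter q w y ≡⟨ ≡.cong (λ k → (+ k) · iter q w y) (nCn≡1 (suc q)) ⟩
      (+ 1) · iter q w y              ≈⟨ ·-identityˡ _ ⟩
      iter q w y                      ∎
      where
      open ∼-Reasoning
      f : Fin (suc q) → Carrier
      f j = (+ (suc q choose suc (toℕ j))) · iter (toℕ j) w y
      inner-term∼ε : ∀ j → f (inject₁ j) ∼ ε
      inner-term∼ε j = p∣⇒·∼ε (+ (suc q choose suc (toℕ (inject₁ j)))) _ (∣ᵤ⇒∣ (p∣C (s≤s z≤n)
        (s≤s (≡.subst (_< q) (≡.sym (toℕ-inject₁ j)) (toℕ<n j)))))

  ν∘w∼iter-p : ∀ w x → νop p w (w x) ∼ iter p w x
  ν∘w∼iter-p w x = helper p ≡.refl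
    where
    helper : ∀ n → n ≡ p → νop n w (w x) ∼ iter n w x
    helper zero    0≡p = ⊥-elim (¬prime[0] (≡.subst Prime (≡.sym 0≡p) p-prime))
    helper (suc q) n≡p = ∼-trans
      (binomial-sum-∼ q w (w x) (λ {k} 0<k k<n →
        ≡.subst (λ n → p ℕ.∣ n choose k) (≡.sym n≡p) (p∣pCk 0<k (≡.subst (k <_) n≡p k<n))))
      (≈⇒∼ (reflexive (iter-suc q w x)))

  iter-cong-∼ : ∀ {g h} → IsEndo g → (∀ x → g x ∼ h x) → ∀ n x → iter n g x ∼ iter n h x
  iter-cong-∼ g-endo g∼h zero    x = ∼-refl
  iter-cong-∼ g-endo g∼h (suc n) x =
    ∼-trans (Homomorphism.f-∼ G G g-endo p (iter-cong-∼ g-endo g∼h n x)) (g∼h _)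

  ∑-iter≈polyApp : ∀ (T : Carrier → Carrier) m (c : Fin m → ℤ) x →
    ∑ m (λ j → c j · iter (toℕ j) T x) ≈ polyApp T (tabulate c) x
  ∑-iter≈polyApp T zero    c x = refl
  ∑-iter≈polyApp T (suc m) c x = ∙-congˡ (trans
    (∑-cong m (λ j → ·-congʳ (c (suc j)) (reflexive (≡.sym (iter-suc (toℕ j) T x)))))
    (∑-iter≈polyApp T m (c ∘ suc) (T x)))

  lowest-unit-term : ∀ (T : Carrier → Carrier) cs x → Any Unit cs →
    Σ ℕ λ s → s < length cs × Σ ℤ λ c → Unit c × Σ (List ℤ) λ rest →
      polyApp T cs x ∼ c · iter s T x ∙ polyApp T rest (T (iter s T x))
  lowest-unit-term T (k ∷ cs) x (here unit-k) = 0 , s≤s z≤n , k , unit-k , cs , ∼-refl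
  lowest-unit-term T (k ∷ cs) x (there unit-in-cs) with + p ∣? k
  ... | no  unit-k = 0 , s≤s z≤n , k , unit-k , cs , ∼-refl
  ... | yes p∣k with lowest-unit-term T cs (T x) unit-in-cs
  ...   | s , s<len , c , unit-c , rest , cs∼ = suc s , s≤s s<len , c , unit-c , rest , (begin
    k · x ∙ polyApp T cs (T x)                                   ∼⟨ ∙-cong-∼ (p∣⇒·∼ε k x p∣k) cs∼ ⟩
    ε ∙ (c · iter s T (T x) ∙ polyApp T rest (T (iter s T (T x)))) ≈⟨ identityˡ _ ⟩
    c · iter s T (T x) ∙ polyApp T rest (T (iter s T (T x)))     ≡⟨ ≡.cong (λ y → c · y ∙ polyApp T rest (T y)) (iter-suc s T x) ⟩
    c · iter (suc s) T x ∙ polyApp T rest (T (iter (suc s) T x)) ∎)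
    where open ∼-Reasoning

  powers-span : ∀ {T} → IsEndo T → ∀ R x → iter R T x ∼ ε →
    ∀ cs → Σ (Fin R → ℤ) λ g → polyApp T cs x ∼ ∑ R (λ i → g i · iter (toℕ i) T x)
  powers-span T-endo R x Tᴿx∼ε []       = (λ _ → + 0) , ≈⇒∼ (sym (∑-zero R))
  powers-span {T} T-endo R x Tᴿx∼ε (k ∷ cs)
    with powers-span T-endo R (T x) (≡.subst (_∼ ε) (≡.sym (iter-suc R T x)) (Homomorphism.f-∼ε G G T-endo p Tᴿx∼ε)) cs
  ... | g , cs∼ = coefficient ∘ inject₁ , (begin
    k · x ∙ polyApp T cs (T x)                              ∼⟨ ∙-cong-∼ ∼-refl cs∼ ⟩
    k · x ∙ ∑ R (λ i → g i · iter (toℕ i) T (T x))          ≈⟨ ∙-congˡ (∑-cong R (λ i → ·-congʳ (g i) (reflexive (iter-suc (toℕ i) T x)))) ⟩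
    ∑ (suc R) term                                          ≈⟨ ∑-init-last R term ⟩
    ∑ R (term ∘ inject₁) ∙ term (fromℕ R)                   ∼⟨ ∙-cong-∼ ∼-refl last-term∼ε ⟩
    ∑ R (term ∘ inject₁) ∙ ε                                ≈⟨ identityʳ _ ⟩
    ∑ R (term ∘ inject₁)                                    ≈⟨ ∑-cong R (λ i → reflexive (≡.cong (λ j → coefficient (inject₁ i) · iter j T x) (toℕ-inject₁ i))) ⟩
    ∑ R (λ i → coefficient (inject₁ i) · iter (toℕ i) T x)  ∎)
    where
    open ∼-Reasoning
    coefficient : Fin (suc R) → ℤ
    coefficient zero    = k
    coefficient (suc i) = g i
    term : Fin (suc R) → Carrier
    term i = coefficient i · iter (toℕ i) T x
    last-term∼ε : term (fromℕ R) ∼ ε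
    last-term∼ε = begin
      term (fromℕ R)                                 ≡⟨ ≡.cong (λ j → coefficient (fromℕ R) · iter j T x) (toℕ-fromℕ R) ⟩
      coefficient (fromℕ R) · iter R T x             ∼⟨ ·-cong-∼ (coefficient (fromℕ R)) Tᴿx∼ε ⟩
      coefficient (fromℕ R) · ε                      ≈⟨ ·-zeroʳ (coefficient (fromℕ R)) ⟩
      ε                                              ∎

  module Nilpotent {T : Carrier → Carrier} (T-endo : IsEndo T) {n : ℕ} (T-nilpotent : ∀ x → iter n T x ∼ ε) where
    open Homomorphism G G T-endo using () renaming (f-· to T-·; f-∙ to T-∙; f-⁻¹ to T-⁻¹; f-cong to T-cong)

    fixpoint∼ε : ∀ {Q} → IsEndo Q → Commute Q T → ∀ {y} → y ∼ T (Q y) → y ∼ ε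
    fixpoint∼ε {Q} Q-endo Q∘T≈T∘Q {y} y∼TQy = begin
      y                        ∼⟨ y∼iter n ⟩
      iter n (T ∘ Q) y         ≈⟨ iter-∘ n y ⟩
      iter n T (iter n Q y)    ∼⟨ T-nilpotent _ ⟩
      ε                        ∎
      where
      open ∼-Reasoning
      y∼iter : ∀ j → y ∼ iter j (T ∘ Q) y
      y∼iter zero    = ∼-refl
      y∼iter (suc j) = ∼-trans y∼TQy (Homomorphism.f-∼ G G (∘-endo T-endo Q-endo) p (y∼iter j))
      iter-∘ : ∀ j x → iter j (T ∘ Q) x ≈ iter j T (iter j Q x)
      iter-∘ zero    x = refl
      iter-∘ (suc j) x =
        T-cong (trans (proj₁ Q-endo (iter-∘ j x)) (commute-iter T-endo Q∘T≈T∘Q j (iter j Q x)))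

    unit-multiple∼ε : ∀ {S} → IsEndo S → Commute S T → ∀ {c y} → Unit c → c · y ∼ T (S y) → y ∼ ε
    unit-multiple∼ε {S} S-endo S∘T≈T∘S {c} {y} unit-c cy∼TSy with unit-inverse unit-c
    ... | c′ , p∣c′c-1 = fixpoint∼ε (·-endo c′ S-endo) (commute-· c′ T-endo S∘T≈T∘S) (begin
      y                ∼⟨ ∼-sym (p∣m-1⇒·∼ (c′ ℤ.* c) y p∣c′c-1) ⟩
      (c′ ℤ.* c) · y   ≈⟨ ·-assoc c′ c y ⟩
      c′ · (c · y)     ∼⟨ ·-cong-∼ c′ cy∼TSy ⟩
      c′ · T (S y)     ≈⟨ T-· c′ (S y) ⟨
      T (c′ · S y)     ∎)
      where open ∼-Reasoning

    low-power-vanishes : ∀ cs h d x → Any Unit cs → length cs ≤ d →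
      polyApp T cs x ∼ polyApp T h (iter d T x) → Σ ℕ λ s → s < length cs × iter s T x ∼ ε
    low-power-vanishes cs h d x unit-in-cs len≤d cs∼h with lowest-unit-term T cs x unit-in-cs
    ... | s , s<len , c , unit-c , rest , cs∼lowest =
      s , s<len , unit-multiple∼ε S-endo S∘T≈T∘S unit-c (let open ∼-Reasoning in begin
        c · y                                              ≈⟨ //-rightDividesʳ _ _ ⟨
        (c · y ∙ polyApp T rest (T y)) ∙ polyApp T rest (T y) ⁻¹ ∼⟨ ∙-cong-∼ (∼-trans (∼-sym cs∼lowest) cs∼h) ∼-refl ⟩
        polyApp T h (iter d T x) ∙ polyApp T rest (T y) ⁻¹    ≈⟨ ∙-cong high-shift (⁻¹-cong (polyApp-commute T-endo rest y)) ⟩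
        T (H y) ∙ T (polyApp T rest y) ⁻¹                   ≈⟨ ∙-congˡ (T-⁻¹ _) ⟨
        T (H y) ∙ T (polyApp T rest y ⁻¹)                   ≈⟨ T-∙ _ _ ⟨
        T (S y)                                            ∎)
      where
      y = iter s T x
      o = d ℕ.∸ suc s
      H : Carrier → Carrier
      H z = polyApp T h (iter o T z)
      S : Carrier → Carrier
      S z = H z ∙ polyApp T rest z ⁻¹
      H-endo : IsEndo H
      H-endo = ∘-endo (polyApp-endo T-endo h) (iter-endo o T-endo)
      S-endo : IsEndo S
      S-endo = ∙-endo H-endo (⁻¹-endo (polyApp-endo T-endo rest))
      S∘T≈T∘S : Commute S T
      S∘T≈T∘S = commute-∙ T-endo (commute-∘ (polyApp-endo T-endo h) (polyApp-commute T-endo h) (iter-commute o T))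
                                 (commute-⁻¹ T-endo (polyApp-commute T-endo rest))
      d≡o+1+s : d ≡ o ℕ.+ suc s
      d≡o+1+s = ≡.sym (ℕ.m∸n+n≡m (ℕ.≤-trans s<len len≤d))
      high-shift : polyApp T h (iter d T x) ≈ T (H y)
      high-shift = begin
        polyApp T h (iter d T x)                ≡⟨ ≡.cong (λ k → polyApp T h (iter k T x)) d≡o+1+s ⟩
        polyApp T h (iter (o ℕ.+ suc s) T x)    ≡⟨ ≡.cong (polyApp T h) (iter-+ o (suc s) T x) ⟩
        polyApp T h (iter o T (T y))            ≈⟨ proj₁ (polyApp-endo T-endo h) (iter-commute o T y) ⟩
        polyApp T h (T (iter o T y))            ≈⟨ polyApp-commute T-endo h _ ⟩
        T (H y)                                 ∎
        where open import Relation.Binary.Reasoning.Setoid setoid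

module ConicTransitionRank {c₁ ℓ₁ c₂ ℓ₂} {p : ℕ} (p-prime : Prime p)
         {A : AbelianGroup c₁ ℓ₁} {B : AbelianGroup c₂ ℓ₂} (C : ConicTransition p A B) where
  open ConicTransition C
  open AbelianGroup B
  open GroupOps B
  open Multiples B
  open CongruenceModP B p
  open Endomorphisms B
  open LinearAlgebraModP B p-prime
  open ModPrime p-prime
  open import Algebra.Properties.AbelianGroup B using (//-rightDividesˡ)
  private
    module A where
      open AbelianGroup A public
      open GroupOps A public
      open Multiples A public
      open CongruenceModP A p public
      open Endomorphisms A public
      open LinearAlgebraModP A p-prime public
    module N = Homomorphism B A N-hom
    module ι = Homomorphism A B ι-hom

  T : Carrier → Carrier
  T = Top τB

  T-endo : IsEndo T
  T-endo = Top-endo τB-hom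

  Tₐ : A.Carrier → A.Carrier
  Tₐ = A.Top τA

  Tₐ-endo : A.IsEndo Tₐ
  Tₐ-endo = A.Top-endo τA-hom

  ω′ : Carrier → Carrier
  ω′ = ωop τB ω

  ω∼Tᵈ : ∀ x → ω′ x ∼ iter d T x
  ω∼Tᵈ = polyApp-∼-iter T d ω (∣ᵤ⇒∣ ω≡Tᵈ-top) (∣ᵤ⇒∣ ∘ ω≡Tᵈ-low)

  ωᵖ∼ε : ∀ x → iter p ω′ x ∼ ε
  ωᵖ∼ε x = begin
    iter p ω′ x        ∼⟨ ∼-sym (ν∘w∼iter-p ω′ x) ⟩
    νop p ω′ (ω′ x)    ≈⟨ ιN≡ν (ω′ x) ⟨
    ι (N (ω′ x))       ≈⟨ ι.f-cong (ωB⊆kerN x) ⟩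
    ι A.ε              ≈⟨ ι.f-ε ⟩
    ε                  ∎
    where open ∼-Reasoning

  Tᵖᵈ∼ε : ∀ x → iter (p ℕ.* d) T x ∼ ε
  Tᵖᵈ∼ε x = begin
    iter (p ℕ.* d) T x     ≡⟨ iter-* p d T x ⟩
    iter p (iter d T) x    ∼⟨ ∼-sym (iter-cong-∼ (polyApp-endo T-endo (toList ω)) ω∼Tᵈ p x) ⟩
    iter p ω′ x            ∼⟨ ωᵖ∼ε x ⟩
    ε                      ∎
    where open ∼-Reasoning

  N-T : ∀ x → N (T x) A.≈ Tₐ (N x)
  N-T x = A.trans (N.f-∙ _ _) (A.∙-cong (N-τ x) (N.f-⁻¹ x))

  N-iter : ∀ n x → N (iter n T x) A.≈ A.iter n Tₐ (N x)
  N-iter zero    x = A.refl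
  N-iter (suc n) x = A.trans (N-T _) (proj₁ Tₐ-endo (N-iter n x))

  N∼ε⇒∼ω : ∀ {x} → N x A.∼ A.ε → Σ Carrier λ y → x ∼ ω′ y
  N∼ε⇒∼ω {x} (z , Nx≈pz) =
    let w , Nw≈z = N-surj z
        y , x-pw≈ω′y = kerN⊆ωB (x ∙ (p ×ₙ w) ⁻¹) (N[x-pw]≈ε w Nw≈z)
    in y , w , trans (sym (//-rightDividesˡ (p ×ₙ w) x)) (∙-congʳ x-pw≈ω′y)
    where
    N[x-pw]≈ε : ∀ w → N w A.≈ z → N (x ∙ (p ×ₙ w) ⁻¹) A.≈ A.ε
    N[x-pw]≈ε w Nw≈z = begin
      N (x ∙ (p ×ₙ w) ⁻¹)                      ≈⟨ N.f-∙ _ _ ⟩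
      N x A.∙ N ((p ×ₙ w) ⁻¹)                  ≈⟨ A.∙-cong Nx≈pz (N.f-⁻¹ _) ⟩
      (A.ε A.∙ p A.×ₙ z) A.∙ N (p ×ₙ w) A.⁻¹   ≈⟨ A.∙-cong (A.identityˡ _) (A.⁻¹-cong (A.trans (N.f-× p w) (A.×-congʳ p Nw≈z))) ⟩
      p A.×ₙ z A.∙ (p A.×ₙ z) A.⁻¹             ≈⟨ A.inverseʳ _ ⟩
      A.ε                                      ∎
      where open import Relation.Binary.Reasoning.Setoid A.setoid

  b : Carrier
  b = proj₁ B-cyclic

  b-generates : ∀ x → Σ (List ℤ) λ f → x ≈ polyApp T f b
  b-generates = proj₂ B-cyclic

  N-∑-powers : ∀ m (c : Fin m → ℤ) x →
    N (∑ m (λ j → c j · iter (toℕ j) T x)) A.≈ A.∑ m (λ j → c j A.· A.iter (toℕ j) Tₐ (N x))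
  N-∑-powers m c x = A.trans (N.f-∑ m _)
    (A.∑-cong m (λ j → A.trans (N.f-· (c j) _) (A.·-congʳ (c j) (N-iter (toℕ j) x))))

  relation-among-NTʲb : Σ (Fin (suc r) → ℤ) λ c → (Σ (Fin (suc r)) λ j → Unit (c j)) ×
    A.∑ (suc r) (λ j → c j A.· A.iter (toℕ j) Tₐ (N b)) A.∼ A.ε
  relation-among-NTʲb = A.spans⇒relation a-spans (ℕ.n<1+n r) (λ j → A.iter (toℕ j) Tₐ (N b))
    where
    a-spans : A.Spans r (λ i → A.iter (toℕ i) Tₐ a)
    a-spans y = proj₁ (a-gen y) , A.≈⇒∼ (proj₂ (a-gen y))

  relation⇒∼Tᵈ : ∀ {m} (c : Fin m → ℤ) → A.∑ m (λ j → c j A.· A.iter (toℕ j) Tₐ (N b)) A.∼ A.ε →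
    Σ (List ℤ) λ h → polyApp T (tabulate c) b ∼ polyApp T h (iter d T b)
  relation⇒∼Tᵈ {m} c relation
    with N∼ε⇒∼ω (A.∼-trans (A.≈⇒∼ (N-∑-powers m c b)) relation)
  ... | y , v∼ω′y with b-generates y
  ...   | h , y≈hb = h , (begin
    polyApp T (tabulate c) b                ≈⟨ ∑-iter≈polyApp T m c b ⟨
    ∑ m (λ j → c j · iter (toℕ j) T b)      ∼⟨ v∼ω′y ⟩
    ω′ y                                    ∼⟨ ω∼Tᵈ y ⟩
    iter d T y                              ≈⟨ proj₁ (iter-endo d T-endo) y≈hb ⟩
    iter d T (polyApp T h b)                ≈⟨ commute-polyApp (iter-endo d T-endo) T-endo (iter-commute d T) h b ⟩
    polyApp T h (iter d T b)                ∎)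
    where open ∼-Reasoning

  low-power-of-b-vanishes : r < d → Σ ℕ λ s → s ≤ r × iter s T b ∼ ε
  low-power-of-b-vanishes r<d =
    let c , (j , unit-cj) , relation = relation-among-NTʲb
        h , c∼h = relation⇒∼Tᵈ c relation
        s , s<len , Tˢb∼ε = Nilpotent.low-power-vanishes T-endo {p ℕ.* d} Tᵖᵈ∼ε (tabulate c) h d b
                              (tabulate⁺ {f = c} j unit-cj) (≡.subst (_≤ d) (≡.sym (length-tabulate c)) r<d) c∼h
    in s , ℕ.≤-pred (≡.subst (s <_) (length-tabulate c) s<len) , Tˢb∼ε

  powers-of-b-span : ∀ {s} → iter s T b ∼ ε → Spans s (λ i → iter (toℕ i) T b)
  powers-of-b-span {s} Tˢb∼ε x =
    let f , x≈fb = b-generates x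
        g , fb∼ = powers-span T-endo s b Tˢb∼ε f
    in g , ∼-trans (≈⇒∼ x≈fb) fb∼

  r′≤r : r < d → r' ≤ r
  r′≤r r<d =
    let s , s≤r , Tˢb∼ε = low-power-of-b-vanishes r<d
    in ℕ.≤-trans (prank≤spans {w = λ i → iter (toℕ i) T b} r'-rank (powers-of-b-span Tˢb∼ε)) s≤r

corollary2 : ∀ {c₁ ℓ₁ c₂ ℓ₂} (p : ℕ) → Prime p →
  (A : AbelianGroup c₁ ℓ₁) (B : AbelianGroup c₂ ℓ₂) (C : ConicTransition p A B) →
  ConicTransition.r C < ConicTransition.d C → ConicTransition.r' C ≡ ConicTransition.r C
corollary2 p p-prime A B C r<d =
  ℕ.≤-antisym (ConicTransitionRank.r′≤r p-prime C r<d) (ConicTransition.r≤r' C)
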